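{- Suppose the following statement (P) holds: there is an absolute constant $C > 0$ such that for every $d \ge 1$ and every $S \subseteq \{0,1\}^d$ with $\mathrm{vol}^+(S) > 0$ and separation distance $r$, in the flow network consisting of the directed $d$-dimensional hypercube with every hypercube edge of capacity $1$ and every hypercube vertex of capacity $r^2$, together with a source supernode having infinite-capacity edges to all vertices of $S$ and a sink supernode having infinite-capacity edges from all vertices of $\overline{S}$, the maximum flow is at least $C\, r\, \mathrm{vol}^+(S)$. Then there is an absolute constant $c > 0$ such that for every $d \ge 1$, every function $f:\{0,1\}^d \to \{0,1\}$, and every coloring $\chi$ of the edges of the directed hypercube with two colors $\{0,1\}$, $$2^{ -d} \sum_{x \in \{0,1\}^d} \sqrt{I^-_{f,\chi}(x)} \ \ge\ c\, \varepsilon_f .$$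
   Context: The directed $d$-dimensional hypercube has vertex set $\{0,1\}^d$ and a directed edge $(x,y)$ whenever $x,y$ differ in exactly one coordinate and $y$ has one more $1$ than $x$. Write $x \prec y$ if $x \ne y$ and $x_i \le y_i$ for all $i$; $|x|$ denotes the number of $1$s in $x$. A matched pair $(S',T';\phi)$ consists of sets $S',T'$ and a bijection $\phi: S'\to T'$ with $s \prec \phi(s)$ for all $s$. For $S \subseteq \{0,1\}^d$ and $\overline{S}$ its complement, the directed volume is $\mathrm{vol}^+(S) = \max\{|S'| : S'\subseteq S, T' \subseteq \overline{S}, \exists\phi, (S',T';\phi)\text{ a matched pair}\}$; any matched pair attaining the maximum is a directed volume certificate. The separation distance of a matched pair $(S',T';\phi)$ is $|S'|^{ -1}\sum_{s\in S'}(|\phi(s)|-|s|)$, and the separation distance of $S$ is the minimum separation distance over all directed volume certificates of $S$. For $f:\{0,1\}^d\to\{0,1\}$, the distance of $f$ to monotonicity $\varepsilon_f$ is the minimum over monotone $g$ (i.e. $g(x)\le g(y)$ whenever $x \prec y$) of $|\{x: f(x)\ne g(x)\}|/2^d$. An edge $(x,y)$ of the hypercube is violated if $f(x) > f(y)$. For a coloring $\chi$ of hypercube edges with colors $0,1$, $I^-_{f,\chi}(x)$ is the number of violated edges incident to $x$ whose color equals $f(x)$. -}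

module Defs where

open import Data.Bool using (Bool; true; false; not; _∧_; _xor_; if_then_else_)
  renaming (_≤_ to _≤ᵇ_)
open import Data.Nat using (ℕ; zero; suc; _∸_; _≤_)
  renaming (_+_ to _+ℕ_)
open import Data.Fin using (Fin)
open import Data.Vec using (Vec; []; _∷_; lookup; updateAt)
open import Data.List using (List; []; _∷_; map; _++_; length; foldr)
import Data.List as L
open import Data.List.Relation.Unary.All using (All)
open import Data.List.Relation.Unary.Unique.Propositional using (Unique)
open import Data.Product using (_×_; _,_; proj₁; proj₂; Σ; ∃)
open import Data.Integer using (+_)
open import Data.Rational using (ℚ; 0ℚ; _/_)
  renaming (_+_ to _+q_; _*_ to _*q_; _≤_ to _≤q_)
open import Relation.Binary.PropositionalEquality using (_≡_; _≢_)

-- The hypercube {0,1}^d  (false = 0, true = 1)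

Vertex : ℕ → Set
Vertex d = Vec Bool d

allVerts : (d : ℕ) → List (Vertex d)
allVerts zero    = [] ∷ []
allVerts (suc d) = map (false ∷_) (allVerts d) ++ map (true ∷_) (allVerts d)

weight : ∀ {d} → Vertex d → ℕ
weight []           = 0
weight (false ∷ xs) = weight xs
weight (true ∷ xs)  = suc (weight xs)

_≼_ : ∀ {d} → Vertex d → Vertex d → Set
_≼_ {d} x y = ∀ (i : Fin d) → lookup x i ≤ᵇ lookup y i

_≺_ : ∀ {d} → Vertex d → Vertex d → Set
x ≺ y = (x ≢ y) × (x ≼ y)

-- flip coordinate i.  A directed hypercube edge is encoded by its tail x
-- and a coordinate i with x_i = 0; its head is  flip x i.
flip : ∀ {d} → Vertex d → Fin d → Vertex d
flip x i = updateAt x i not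

sumℕ : List ℕ → ℕ
sumℕ = foldr _+ℕ_ 0

sumℚ : List ℚ → ℚ
sumℚ = foldr _+q_ 0ℚ

ℕ→ℚ : ℕ → ℚ
ℕ→ℚ n = + n / 1

ind : Bool → ℕ
ind b = if b then 1 else 0

allCoords : (d : ℕ) → List (Fin d)
allCoords d = Data.List.allFin d

-- A matched pair (S',T';φ) with S' ⊆ S, T' ⊆ complement of S is encoded
-- by the graph of φ: a list of pairs (s , φ s) with pairwise distinct
-- first components (S' is a set) and pairwise distinct second components
-- (φ injective, hence a bijection onto T').

Matching : ℕ → Set
Matching d = List (Vertex d × Vertex d)

IsMatchedPairIn : ∀ {d} → (Vertex d → Bool) → Matching d → Set
IsMatchedPairIn S ps =
  All (λ p → (S (proj₁ p) ≡ true) × (S (proj₂ p) ≡ false) × (proj₁ p ≺ proj₂ p)) ps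
  × Unique (map proj₁ ps)
  × Unique (map proj₂ ps)

IsVolCert : ∀ {d} → (Vertex d → Bool) → Matching d → Set
IsVolCert {d} S ps =
  IsMatchedPairIn S ps × (∀ (qs : Matching d) → IsMatchedPairIn S qs → length qs ≤ length ps)

IsDirVol : ∀ {d} → (Vertex d → Bool) → ℕ → Set
IsDirVol {d} S v = Σ (Matching d) λ ps → IsVolCert S ps × length ps ≡ v

sepSum : ∀ {d} → Matching d → ℕ
sepSum ps = sumℕ (map (λ p → weight (proj₂ p) ∸ weight (proj₁ p)) ps)

-- the separation distance of the matched pair ps equals r,
-- i.e. r = |S'|⁻¹ Σ (|φ s| - |s|)   (written as r·|S'| = Σ …; ps nonempty)
SepDistOfPairIs : ∀ {d} → Matching d → ℚ → Set
SepDistOfPairIs ps r = (1 ≤ length ps) × (r *q ℕ→ℚ (length ps) ≡ ℕ→ℚ (sepSum ps))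

IsSepDist : ∀ {d} → (Vertex d → Bool) → ℚ → Set
IsSepDist {d} S r =
  (Σ (Matching d) λ ps → IsVolCert S ps × SepDistOfPairIs ps r)
  × (∀ (ps : Matching d) (r' : ℚ) → IsVolCert S ps → SepDistOfPairIs ps r' → r ≤q r')

-- Flows in the network of claim (P):
--   hypercube edges (x → flip x i, x_i = 0) of capacity 1,
--   hypercube vertices of capacity r²,
--   source → s (s ∈ S) and t → sink (t ∉ S) of infinite capacity.

record Flow (d : ℕ) : Set where
  field
    edgeFlow : Vertex d → Fin d → ℚ   -- flow on edge (x , flip x i); only used when x_i = 0
    srcFlow  : Vertex d → ℚ
    snkFlow  : Vertex d → ℚ
open Flow public

inflow : ∀ {d} → Flow d → Vertex d → ℚ
inflow {d} F x =
  srcFlow F x +q sumℚ (map (λ i → if lookup x i then edgeFlow F (flip x i) i else 0ℚ) (allCoords d))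

outflow : ∀ {d} → Flow d → Vertex d → ℚ
outflow {d} F x =
  snkFlow F x +q sumℚ (map (λ i → if lookup x i then 0ℚ else edgeFlow F x i) (allCoords d))

flowValue : ∀ {d} → Flow d → ℚ
flowValue {d} F = sumℚ (map (srcFlow F) (allVerts d))

IsFeasibleFlow : ∀ {d} → (Vertex d → Bool) → (r : ℚ) → Flow d → Set
IsFeasibleFlow {d} S r F =
  (∀ (x : Vertex d) (i : Fin d) → lookup x i ≡ false → (0ℚ ≤q edgeFlow F x i) × (edgeFlow F x i ≤q ℕ→ℚ 1))
  × (∀ (x : Vertex d) (i : Fin d) → lookup x i ≡ true → edgeFlow F x i ≡ 0ℚ)
  -- source edges exist exactly to vertices of S, sink edges exactly from vertices of the complement
  × (∀ (x : Vertex d) → 0ℚ ≤q srcFlow F x)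
  × (∀ (x : Vertex d) → S x ≡ false → srcFlow F x ≡ 0ℚ)
  × (∀ (x : Vertex d) → 0ℚ ≤q snkFlow F x)
  × (∀ (x : Vertex d) → S x ≡ true → snkFlow F x ≡ 0ℚ)
  × (∀ (x : Vertex d) → inflow F x ≡ outflow F x)
  × (∀ (x : Vertex d) → inflow F x ≤q r *q r)

MaxFlowAtLeast : ∀ {d} → (Vertex d → Bool) → (r : ℚ) → ℚ → Set
MaxFlowAtLeast {d} S r m = Σ (Flow d) λ F → IsFeasibleFlow S r F × (m ≤q flowValue F)

PropertyP : Set
PropertyP =
  Σ ℚ λ C → (0ℚ Data.Rational.< C) ×
    (∀ (d : ℕ) → 1 ≤ d → ∀ (S : Vertex d → Bool) (v : ℕ) (r : ℚ) →
       IsDirVol S v → 1 ≤ v → IsSepDist S r →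
       MaxFlowAtLeast S r (C *q r *q ℕ→ℚ v))

-- Distance to monotonicity (as a count; ε_f = count / 2^d)

Monotone : ∀ {d} → (Vertex d → Bool) → Set
Monotone {d} g = ∀ (x y : Vertex d) → x ≺ y → g x ≤ᵇ g y

disagree : ∀ {d} → (Vertex d → Bool) → (Vertex d → Bool) → ℕ
disagree {d} f g = sumℕ (map (λ x → ind (f x xor g x)) (allVerts d))

IsDistMonoCount : ∀ {d} → (Vertex d → Bool) → ℕ → Set
IsDistMonoCount {d} f k =
  (Σ (Vertex d → Bool) λ g → Monotone g × disagree f g ≡ k)
  × (∀ (g : Vertex d → Bool) → Monotone g → k ≤ disagree f g)

-- Colorings and I⁻_{f,χ}.  A coloring assigns to the edge (x , flip x i)
-- (x_i = 0) the color χ x i; values of χ at x_i = 1 are irrelevant.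

Coloring : ℕ → Set
Coloring d = Vertex d → Fin d → Bool

_==ᵇ_ : Bool → Bool → Bool
a ==ᵇ b = not (a xor b)

-- I⁻_{f,χ}(x): violated edges incident to x whose color equals f(x)
Iminus : ∀ {d} → (Vertex d → Bool) → Coloring d → Vertex d → ℕ
Iminus {d} f χ x = sumℕ (map count (allCoords d))
  where
  count : Fin d → ℕ
  count i with lookup x i
  ... | false = ind (f x ∧ not (f (flip x i)) ∧ (χ x i ==ᵇ f x))
  ... | true  = ind (f (flip x i) ∧ not (f x) ∧ (χ (flip x i) i ==ᵇ f x))

-- Σ_x √(a x) ≥ m, expressed without reals:  for every choice of rationals
-- u x ≥ 0 with u x² ≥ a x (i.e. u x ≥ √(a x)), Σ_x u x ≥ m.
-- (Exact, since √n is the infimum of such rational upper bounds.)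
SqrtSumAtLeast : ∀ {d} → (Vertex d → ℕ) → ℚ → Set
SqrtSumAtLeast {d} a m =
  ∀ (u : Vertex d → ℚ) → (∀ (x : Vertex d) → (0ℚ ≤q u x) × (ℕ→ℚ (a x) ≤q u x *q u x)) →
    m ≤q sumℚ (map u (allVerts d))

{-# OPTIONS --safe #-}
-- Let S = f⁻¹(1) and let M be a directed volume certificate of S, i.e. a maximum matched pair.
-- By maximality no unmatched point of S lies below an unmatched point outside S, so the
-- up-closure of the unmatched points of S is monotone and differs from f only at the
-- 2 vol⁺(S) matched vertices: ε_f 2^d ≤ 2 vol⁺(S).  On the other hand, all flow of a
-- feasible flow in the network of (P) leaves S through violated edges.  Charge the flow
-- on a violated edge to the endpoint x whose value f(x) is the colour of the edge: as edges
-- carry at most 1 and vertices at most r², x is charged at most min(I⁻(x), r²) ≤ r √I⁻(x).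
-- Hence C r vol⁺(S) ≤ r Σₓ √I⁻(x), and c = C/2 works.

module Submission where

open import Defs
open import Data.Nat using (ℕ; _≤_)
open import Data.Rational using (ℚ; 0ℚ; _<_; _*_)
open import Data.Product using (Σ; _×_)
open import Data.Bool using (Bool)

open import Algebra.Bundles using (CommutativeMonoid)
import Algebra.Properties.CommutativeSemigroup as CommutativeSemigroupProperties
open import Data.Bool using (true; false; not; _∧_; _xor_; if_then_else_; T)
import Data.Bool.Properties as Boolₚ
open import Data.Empty using (⊥; ⊥-elim)
open import Data.Unit using (tt)
open import Data.Fin using (Fin; zero; suc)
import Data.Fin.Properties as Finₚ
open import Data.Integer using (+_)
import Data.Integer as ℤ
import Data.Integer.Properties as ℤₚ
open import Data.List using (List; []; _∷_; map; _++_; length; foldr; cartesianProductWith; cartesianProduct)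
import Data.List.Properties as Listₚ
open import Data.List.Membership.Propositional using (_∈_; _∉_)
open import Data.List.Membership.Propositional.Properties
  using (∈-++⁺ˡ; ∈-++⁺ʳ; ∈-map⁺; ∈-cartesianProductWith⁺; ∈-cartesianProduct⁺)
open import Data.List.Relation.Unary.All using (All; []; _∷_; all?)
open import Data.List.Relation.Unary.All.Properties using (¬Any⇒All¬)
open import Data.List.Relation.Unary.Any using (Any; here; there; any?)
import Data.List.Relation.Unary.Any as Any
open import Data.List.Relation.Unary.AllPairs using ([]; _∷_)
open import Data.List.Relation.Unary.Unique.Propositional using (Unique)
import Data.List.Relation.Unary.Unique.DecPropositional as UniqueDec
open import Data.Nat using (zero; suc; _+_; z≤n; s≤s)
import Data.Nat as ℕ
import Data.Nat.Properties as ℕₚ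
open import Data.Nat.Coprimality using (1-coprimeTo)
import Data.Nat.Coprimality as Coprimality
open import Data.Nat.Induction using (<-rec)
open import Data.Rational using (1ℚ; ½; mkℚ; *≤*; *<*; -_; _÷_)
  renaming (_+_ to _+q_; _≤_ to _≤q_)
import Data.Rational as ℚ
import Data.Rational.Properties as ℚₚ
open import Data.Product using (_,_; proj₁; proj₂; ∃)
open import Data.Sum using (inj₁; inj₂)
open import Data.Vec using ([]; _∷_; lookup)
import Data.Vec.Properties as Vecₚ
open import Function using (_∘_; case_of_)
open import Relation.Binary.PropositionalEquality
open import Relation.Nullary using (Dec; yes; no; ¬?; does)
open import Relation.Nullary.Decidable using (isYes; isYes≗does; dec-true; toWitness; _×-dec_)
open import Relation.Unary using (Decidable)

ℕ→ℚ≡mkℚ : ∀ n → ℕ→ℚ n ≡ mkℚ (+ n) 0 (Coprimality.sym (1-coprimeTo n))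
ℕ→ℚ≡mkℚ n = ℚₚ.normalize-coprime (Coprimality.sym (1-coprimeTo n))

ℕ→ℚ-+ : ∀ m n → ℕ→ℚ (m + n) ≡ ℕ→ℚ m +q ℕ→ℚ n
ℕ→ℚ-+ m n rewrite ℕ→ℚ≡mkℚ m | ℕ→ℚ≡mkℚ n =
  cong (ℚ._/ 1) (sym (cong₂ ℤ._+_ (ℤₚ.*-identityʳ (+ m)) (ℤₚ.*-identityʳ (+ n))))

ℕ→ℚ-mono-≤ : ∀ {m n} → m ≤ n → ℕ→ℚ m ≤q ℕ→ℚ n
ℕ→ℚ-mono-≤ {m} {n} m≤n rewrite ℕ→ℚ≡mkℚ m | ℕ→ℚ≡mkℚ n =
  *≤* (subst₂ ℤ._≤_ (sym (ℤₚ.*-identityʳ (+ m))) (sym (ℤₚ.*-identityʳ (+ n))) (ℤ.+≤+ m≤n))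

ℕ→ℚ-mono-< : ∀ {m n} → m ℕ.< n → ℕ→ℚ m < ℕ→ℚ n
ℕ→ℚ-mono-< {m} {n} m<n rewrite ℕ→ℚ≡mkℚ m | ℕ→ℚ≡mkℚ n =
  *<* (subst₂ ℤ._<_ (sym (ℤₚ.*-identityʳ (+ m))) (sym (ℤₚ.*-identityʳ (+ n))) (ℤ.+<+ m<n))

ℕ→ℚ-nonneg : ∀ n → 0ℚ ≤q ℕ→ℚ n
ℕ→ℚ-nonneg n = ℕ→ℚ-mono-≤ {0} {n} z≤n

ℕ→ℚ-sum : ∀ ns → ℕ→ℚ (sumℕ ns) ≡ sumℚ (map ℕ→ℚ ns)
ℕ→ℚ-sum []       = refl
ℕ→ℚ-sum (n ∷ ns) = trans (ℕ→ℚ-+ n (sumℕ ns)) (cong (ℕ→ℚ n +q_) (ℕ→ℚ-sum ns))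

-- Sums

module ListSum {c ℓ} (M : CommutativeMonoid c ℓ) where

  open CommutativeMonoid M
    using (_≈_; _∙_; ε; assoc; identityˡ; comm; ∙-cong; ∙-congˡ; commutativeSemigroup)
    renaming (Carrier to R; refl to ≈-refl; sym to ≈-sym; trans to ≈-trans; setoid to ≈-setoid)
  open CommutativeSemigroupProperties commutativeSemigroup using (interchange)
  open import Relation.Binary.Reasoning.Setoid ≈-setoid

  sum : List R → R
  sum = foldr _∙_ ε

  sum-++ : ∀ xs ys → sum (xs ++ ys) ≈ sum xs ∙ sum ys
  sum-++ []       ys = ≈-sym (identityˡ (sum ys))
  sum-++ (x ∷ xs) ys = begin
    x ∙ sum (xs ++ ys)      ≈⟨ ∙-congˡ (sum-++ xs ys) ⟩
    x ∙ (sum xs ∙ sum ys)   ≈⟨ assoc x (sum xs) (sum ys) ⟨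
    (x ∙ sum xs) ∙ sum ys   ∎

  module _ {a} {A : Set a} where

    sum-map-ε : ∀ (xs : List A) → sum (map (λ _ → ε) xs) ≈ ε
    sum-map-ε []       = ≈-refl
    sum-map-ε (x ∷ xs) = ≈-trans (identityˡ _) (sum-map-ε xs)

    sum-map-∙ : ∀ (g h : A → R) xs → sum (map (λ x → g x ∙ h x) xs) ≈ sum (map g xs) ∙ sum (map h xs)
    sum-map-∙ g h []       = ≈-sym (identityˡ ε)
    sum-map-∙ g h (x ∷ xs) = begin
      (g x ∙ h x) ∙ sum (map (λ x → g x ∙ h x) xs)        ≈⟨ ∙-congˡ (sum-map-∙ g h xs) ⟩
      (g x ∙ h x) ∙ (sum (map g xs) ∙ sum (map h xs))     ≈⟨ interchange (g x) (h x) _ _ ⟩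
      (g x ∙ sum (map g xs)) ∙ (h x ∙ sum (map h xs))     ∎

  sum-map-comm : ∀ {a b} {A : Set a} {B : Set b} (g : A → B → R) xs ys →
    sum (map (λ x → sum (map (g x) ys)) xs) ≈ sum (map (λ y → sum (map (λ x → g x y) xs)) ys)
  sum-map-comm g []       ys = ≈-sym (sum-map-ε ys)
  sum-map-comm g (x ∷ xs) ys = begin
    sum (map (g x) ys) ∙ sum (map (λ x → sum (map (g x) ys)) xs)
      ≈⟨ ∙-congˡ (sum-map-comm g xs ys) ⟩
    sum (map (g x) ys) ∙ sum (map (λ y → sum (map (λ x → g x y) xs)) ys)
      ≈⟨ sum-map-∙ (g x) (λ y → sum (map (λ x → g x y) xs)) ys ⟨
    sum (map (λ y → g x y ∙ sum (map (λ x → g x y) xs)) ys)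
      ∎

  sum-allVerts-suc : ∀ d (h : Vertex (suc d) → R) →
    sum (map h (allVerts (suc d))) ≈
    sum (map (h ∘ (false ∷_)) (allVerts d)) ∙ sum (map (h ∘ (true ∷_)) (allVerts d))
  sum-allVerts-suc d h = begin
    sum (map h (map (false ∷_) xs ++ map (true ∷_) xs))
      ≡⟨ cong sum (Listₚ.map-++ h (map (false ∷_) xs) (map (true ∷_) xs)) ⟩
    sum (map h (map (false ∷_) xs) ++ map h (map (true ∷_) xs))
      ≈⟨ sum-++ (map h (map (false ∷_) xs)) (map h (map (true ∷_) xs)) ⟩
    sum (map h (map (false ∷_) xs)) ∙ sum (map h (map (true ∷_) xs))
      ≡⟨ cong₂ _∙_ (cong sum (Listₚ.map-∘ xs)) (cong sum (Listₚ.map-∘ xs)) ⟨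
    sum (map (h ∘ (false ∷_)) xs) ∙ sum (map (h ∘ (true ∷_)) xs)
      ∎
    where xs = allVerts d

  sum-flip : ∀ d (i : Fin d) (h : Vertex d → R) →
    sum (map (λ x → h (flip x i)) (allVerts d)) ≈ sum (map h (allVerts d))
  sum-flip (suc d) zero h = begin
    sum (map (λ x → h (flip x zero)) (allVerts (suc d)))
      ≈⟨ sum-allVerts-suc d (λ x → h (flip x zero)) ⟩
    sum (map (h ∘ (true ∷_)) (allVerts d)) ∙ sum (map (h ∘ (false ∷_)) (allVerts d))
      ≈⟨ comm _ _ ⟩
    sum (map (h ∘ (false ∷_)) (allVerts d)) ∙ sum (map (h ∘ (true ∷_)) (allVerts d))
      ≈⟨ sum-allVerts-suc d h ⟨
    sum (map h (allVerts (suc d)))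
      ∎
  sum-flip (suc d) (suc i) h = begin
    sum (map (λ x → h (flip x (suc i))) (allVerts (suc d)))
      ≈⟨ sum-allVerts-suc d (λ x → h (flip x (suc i))) ⟩
    sum (map (λ x → h (false ∷ flip x i)) (allVerts d)) ∙ sum (map (λ x → h (true ∷ flip x i)) (allVerts d))
      ≈⟨ ∙-cong (sum-flip d i (h ∘ (false ∷_))) (sum-flip d i (h ∘ (true ∷_))) ⟩
    sum (map (h ∘ (false ∷_)) (allVerts d)) ∙ sum (map (h ∘ (true ∷_)) (allVerts d))
      ≈⟨ sum-allVerts-suc d h ⟨
    sum (map h (allVerts (suc d)))
      ∎

module ℕΣ = ListSum ℕₚ.+-0-commutativeMonoid
module ℚΣ = ListSum ℚₚ.+-0-commutativeMonoid

module _ {a} {A : Set a} where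

  sumℚ-mono-≤ : ∀ {g h : A → ℚ} xs → (∀ x → g x ≤q h x) → sumℚ (map g xs) ≤q sumℚ (map h xs)
  sumℚ-mono-≤ []       g≤h = ℚₚ.≤-refl
  sumℚ-mono-≤ (x ∷ xs) g≤h = ℚₚ.+-mono-≤ (g≤h x) (sumℚ-mono-≤ xs g≤h)

  sumℚ-nonneg : ∀ {g : A → ℚ} xs → (∀ x → 0ℚ ≤q g x) → 0ℚ ≤q sumℚ (map g xs)
  sumℚ-nonneg xs g≥0 = subst (_≤q sumℚ (map _ xs)) (ℚΣ.sum-map-ε xs) (sumℚ-mono-≤ xs g≥0)

  sumℚ-*ˡ : ∀ r (g : A → ℚ) xs → sumℚ (map (λ x → r * g x) xs) ≡ r * sumℚ (map g xs)
  sumℚ-*ˡ r g []       = sym (ℚₚ.*-zeroʳ r)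
  sumℚ-*ˡ r g (x ∷ xs) = trans (cong (r * g x +q_) (sumℚ-*ˡ r g xs)) (sym (ℚₚ.*-distribˡ-+ r (g x) _))

  sumℕ-mono-≤ : ∀ {g h : A → ℕ} xs → (∀ x → g x ≤ h x) → sumℕ (map g xs) ≤ sumℕ (map h xs)
  sumℕ-mono-≤ []       g≤h = z≤n
  sumℕ-mono-≤ (x ∷ xs) g≤h = ℕₚ.+-mono-≤ (g≤h x) (sumℕ-mono-≤ xs g≤h)

  sumℕ-map-1 : ∀ (xs : List A) → sumℕ (map (λ _ → 1) xs) ≡ length xs
  sumℕ-map-1 []       = refl
  sumℕ-map-1 (x ∷ xs) = cong suc (sumℕ-map-1 xs)

-- The hypercube

∈-allVerts : ∀ {d} (x : Vertex d) → x ∈ allVerts d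
∈-allVerts []                  = here refl
∈-allVerts {suc d} (false ∷ x) = ∈-++⁺ˡ (∈-map⁺ (false ∷_) (∈-allVerts x))
∈-allVerts {suc d} (true ∷ x)  = ∈-++⁺ʳ (map (false ∷_) (allVerts d)) (∈-map⁺ (true ∷_) (∈-allVerts x))

flip-involutive : ∀ {d} (x : Vertex d) (i : Fin d) → flip (flip x i) i ≡ x
flip-involutive (false ∷ x) zero    = refl
flip-involutive (true ∷ x)  zero    = refl
flip-involutive (b ∷ x)     (suc i) = cong (b ∷_) (flip-involutive x i)

lookup-flip : ∀ {d} (x : Vertex d) (i : Fin d) → lookup (flip x i) i ≡ not (lookup x i)
lookup-flip x i = Vecₚ.lookup∘updateAt i x

_≟V_ : ∀ {d} (x y : Vertex d) → Dec (x ≡ y)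
_≟V_ = Vecₚ.≡-dec Boolₚ._≟_

_≼?_ : ∀ {d} (x y : Vertex d) → Dec (x ≼ y)
x ≼? y = Finₚ.all? (λ i → lookup x i Boolₚ.≤? lookup y i)

≼⇒weight≤ : ∀ {d} {x y : Vertex d} → x ≼ y → weight x ≤ weight y
≼⇒weight≤ {x = []}         {[]}         x≼y = z≤n
≼⇒weight≤ {x = false ∷ x} {false ∷ y} x≼y = ≼⇒weight≤ {x = x} {y} (x≼y ∘ suc)
≼⇒weight≤ {x = false ∷ x} {true ∷ y}  x≼y = ℕₚ.m≤n⇒m≤1+n (≼⇒weight≤ {x = x} {y} (x≼y ∘ suc))
≼⇒weight≤ {x = true ∷ x}  {true ∷ y}  x≼y = s≤s (≼⇒weight≤ {x = x} {y} (x≼y ∘ suc))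
≼⇒weight≤ {x = true ∷ x}  {false ∷ y} x≼y with x≼y zero
... | ()

≺⇒weight< : ∀ {d} {x y : Vertex d} → x ≺ y → weight x ℕ.< weight y
≺⇒weight< {x = []}         {[]}         (x≢y , _)   = ⊥-elim (x≢y refl)
≺⇒weight< {x = false ∷ x} {false ∷ y} (x≢y , x≼y) = ≺⇒weight< {x = x} {y} ((x≢y ∘ cong (false ∷_)) , x≼y ∘ suc)
≺⇒weight< {x = false ∷ x} {true ∷ y}  (_ , x≼y)   = s≤s (≼⇒weight≤ {x = x} {y} (x≼y ∘ suc))
≺⇒weight< {x = true ∷ x}  {true ∷ y}  (x≢y , x≼y) = s≤s (≺⇒weight< {x = x} {y} ((x≢y ∘ cong (true ∷_)) , x≼y ∘ suc))
≺⇒weight< {x = true ∷ x}  {false ∷ y} (_ , x≼y) with x≼y zero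
... | ()

occurrences : ∀ {d} → Vertex d → List (Vertex d) → ℕ
occurrences x ys = sumℕ (map (λ y → ind (does (x ≟V y))) ys)

sum-indicator-≟ : ∀ d (y : Vertex d) → sumℕ (map (λ x → ind (does (x ≟V y))) (allVerts d)) ≡ 1
sum-indicator-≟ zero    []          = refl
sum-indicator-≟ (suc d) (false ∷ y) = trans (ℕΣ.sum-allVerts-suc d (λ x → ind (does (x ≟V (false ∷ y)))))
  (cong₂ _+_ (sum-indicator-≟ d y) (ℕΣ.sum-map-ε (allVerts d)))
sum-indicator-≟ (suc d) (true ∷ y)  = trans (ℕΣ.sum-allVerts-suc d (λ x → ind (does (x ≟V (true ∷ y)))))
  (cong₂ _+_ (ℕΣ.sum-map-ε (allVerts d)) (sum-indicator-≟ d y))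

sum-occurrences : ∀ d (ys : List (Vertex d)) → sumℕ (map (λ x → occurrences x ys) (allVerts d)) ≡ length ys
sum-occurrences d []       = ℕΣ.sum-map-ε (allVerts d)
sum-occurrences d (y ∷ ys) = begin
  sumℕ (map (λ x → ind (does (x ≟V y)) + occurrences x ys) (allVerts d))
    ≡⟨ ℕΣ.sum-map-∙ (λ x → ind (does (x ≟V y))) (λ x → occurrences x ys) (allVerts d) ⟩
  sumℕ (map (λ x → ind (does (x ≟V y))) (allVerts d)) + sumℕ (map (λ x → occurrences x ys) (allVerts d))
    ≡⟨ cong₂ _+_ (sum-indicator-≟ d y) (sum-occurrences d ys) ⟩
  suc (length ys)
    ∎
  where open ≡-Reasoning

occurrences-∉ : ∀ {d} {x : Vertex d} ys → All (x ≢_) ys → occurrences x ys ≡ 0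
occurrences-∉     []       []             = refl
occurrences-∉ {x = x} (y ∷ ys) (x≢y ∷ x∉ys) with x ≟V y
... | yes x≡y = ⊥-elim (x≢y x≡y)
... | no _    = occurrences-∉ ys x∉ys

occurrences-unique : ∀ {d} (x : Vertex d) ys → Unique ys → occurrences x ys ≤ 1
occurrences-unique x []       []                = z≤n
occurrences-unique x (y ∷ ys) (y∉ys ∷ ys-unique) with x ≟V y
... | yes refl = ℕₚ.≤-reflexive (cong suc (occurrences-∉ ys y∉ys))
... | no _     = occurrences-unique x ys ys-unique

∈⇒occurrences-pos : ∀ {d} {x : Vertex d} {ys} → x ∈ ys → 1 ≤ occurrences x ys
∈⇒occurrences-pos {x = x} {y ∷ ys} x∈ys with x ≟V y | x∈ys
... | yes _ | _           = s≤s z≤n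
... | no x≢y | here x≡y   = ⊥-elim (x≢y x≡y)
... | no _  | there x∈ys′ = ∈⇒occurrences-pos x∈ys′

unique⇒length≤ : ∀ {d} (ys : List (Vertex d)) → Unique ys → length ys ≤ length (allVerts d)
unique⇒length≤ {d} ys ys-unique = begin
  length ys                                            ≡⟨ sum-occurrences d ys ⟨
  sumℕ (map (λ x → occurrences x ys) (allVerts d))    ≤⟨ sumℕ-mono-≤ (allVerts d) (λ x → occurrences-unique x ys ys-unique) ⟩
  sumℕ (map (λ _ → 1) (allVerts d))                   ≡⟨ sumℕ-map-1 (allVerts d) ⟩
  length (allVerts d)                                  ∎
  where open ℕₚ.≤-Reasoning

-- Directed volume and separation distance

module _ {p} {P : ℕ → Set p} (P? : Decidable P) where

  greatest : P 0 → ∀ b → (∀ {n} → P n → n ≤ b) → ∃ λ m → P m × (∀ {n} → P n → n ≤ m)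
  greatest P0 b bounded with P? b
  ... | yes Pb = b , Pb , bounded
  greatest P0 zero    bounded | no ¬P0 = ⊥-elim (¬P0 P0)
  greatest P0 (suc b) bounded | no ¬Pb =
    greatest P0 b (λ Pn → ℕₚ.m<1+n⇒m≤n (ℕₚ.≤∧≢⇒< (bounded Pn) λ { refl → ¬Pb Pn }))

  least : ∀ {m} → P m → ∃ λ n → P n × (∀ {k} → P k → n ≤ k)
  least {m} = <-rec (λ m → P m → ∃ λ n → P n × (∀ {k} → P k → n ≤ k)) search m
    where
    search : ∀ m → (∀ {k} → k ℕ.< m → P k → ∃ λ n → P n × (∀ {k} → P k → n ≤ k)) →
             P m → ∃ λ n → P n × (∀ {k} → P k → n ≤ k)
    search m below Pm with ℕₚ.anyUpTo? P? m
    ... | yes (k , k<m , Pk) = below k<m Pk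
    ... | no none            = m , Pm , λ Pk → ℕₚ.≮⇒≥ λ k<m → none (_ , k<m , Pk)

listsOfLength : ∀ {a} {A : Set a} → ℕ → List A → List (List A)
listsOfLength zero    xs = [] ∷ []
listsOfLength (suc n) xs = cartesianProductWith _∷_ xs (listsOfLength n xs)

∈-listsOfLength : ∀ {a} {A : Set a} {xs : List A} ys → All (_∈ xs) ys → ys ∈ listsOfLength (length ys) xs
∈-listsOfLength []       []              = here refl
∈-listsOfLength (y ∷ ys) (y∈xs ∷ ys⊆xs) = ∈-cartesianProductWith⁺ _∷_ y∈xs (∈-listsOfLength ys ys⊆xs)

vertexPairs : ∀ d → List (Vertex d × Vertex d)
vertexPairs d = cartesianProduct (allVerts d) (allVerts d)

⊆-vertexPairs : ∀ {d} (ps : Matching d) → All (_∈ vertexPairs d) ps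
⊆-vertexPairs []             = []
⊆-vertexPairs ((x , y) ∷ ps) = ∈-cartesianProduct⁺ (∈-allVerts x) (∈-allVerts y) ∷ ⊆-vertexPairs ps

isMatchedPairIn? : ∀ {d} (S : Vertex d → Bool) → Decidable (IsMatchedPairIn S)
isMatchedPairIn? S ps =
  all? (λ (s , t) → (S s Boolₚ.≟ true) ×-dec (S t Boolₚ.≟ false) ×-dec (¬? (s ≟V t) ×-dec (s ≼? t))) ps
  ×-dec UniqueDec.unique? _≟V_ (map proj₁ ps)
  ×-dec UniqueDec.unique? _≟V_ (map proj₂ ps)

matchingOfLength? : ∀ {d} {R : Matching d → Set} → Decidable R → ∀ n → Dec (Σ (Matching d) λ ps → R ps × length ps ≡ n)
matchingOfLength? {d} R? n with any? (λ ps → R? ps ×-dec (length ps ℕ.≟ n)) (listsOfLength n (vertexPairs d))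
... | yes found = yes (Any.satisfied found)
... | no none   = no λ { (ps , Rps , refl) →
  none (Any.map (λ { refl → Rps , refl }) (∈-listsOfLength ps (⊆-vertexPairs ps))) }

÷-*-cancel : ∀ p q .{{_ : ℚ.NonZero q}} → (p ÷ q) * q ≡ p
÷-*-cancel p q = begin
  p * ℚ.1/ q * q     ≡⟨ ℚₚ.*-assoc p (ℚ.1/ q) q ⟩
  p * (ℚ.1/ q * q)   ≡⟨ cong (p *_) (ℚₚ.*-inverseˡ q) ⟩
  p * 1ℚ             ≡⟨ ℚₚ.*-identityʳ p ⟩
  p                  ∎
  where open ≡-Reasoning

module _ {d} (S : Vertex d → Bool) where

  matchedPair-length≤ : ∀ {ps} → IsMatchedPairIn S ps → length ps ≤ length (allVerts d)
  matchedPair-length≤ {ps} (_ , sources-unique , _) =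
    subst (_≤ length (allVerts d)) (Listₚ.length-map proj₁ ps) (unique⇒length≤ (map proj₁ ps) sources-unique)

  volCert-exists : Σ (Matching d) (IsVolCert S)
  volCert-exists with greatest (matchingOfLength? (isMatchedPairIn? S)) ([] , ([] , [] , []) , refl)
                      (length (allVerts d)) (λ { (ps , mp , refl) → matchedPair-length≤ mp })
  ... | _ , (M , mp , refl) , maximal = M , mp , λ qs mq → maximal (qs , mq , refl)

  volCert-length : ∀ {ps qs} → IsVolCert S ps → IsVolCert S qs → length ps ≡ length qs
  volCert-length {ps} {qs} (mp , p-max) (mq , q-max) = ℕₚ.≤-antisym (q-max ps mp) (p-max qs mq)

  sepSum-pos : ∀ {ps} → IsMatchedPairIn S ps → 1 ≤ length ps → 1 ≤ sepSum ps
  sepSum-pos {(s , t) ∷ ps} ((_ , _ , s≺t) ∷ _ , _) _ =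
    ℕₚ.≤-trans (ℕₚ.m<n⇒0<n∸m (≺⇒weight< s≺t)) (ℕₚ.m≤m+n _ (sepSum ps))

  minSepCert : ∀ {M} → IsVolCert S M →
    Σ (Matching d) λ P → IsVolCert S P × (∀ {ps} → IsVolCert S ps → sepSum P ≤ sepSum ps)
  minSepCert {M} cert@(mM , M-max)
    with least (λ m → matchingOfLength? (λ ps → isMatchedPairIn? S ps ×-dec (sepSum ps ℕ.≟ m)) (length M))
               {sepSum M} (M , (mM , refl) , refl)
  ... | _ , (P , (mP , refl) , |P|≡|M|) , minimal =
    P , certP , λ {ps} cert-ps → minimal (ps , (proj₁ cert-ps , refl) , volCert-length cert-ps cert)
    where
    certP : IsVolCert S P
    certP = mP , λ qs mq → subst (length qs ≤_) (sym |P|≡|M|) (M-max qs mq)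

  sepDist-exists : ∀ {M} → IsVolCert S M → 1 ≤ length M → Σ ℚ λ r → 0ℚ < r × IsSepDist S r
  sepDist-exists cert 1≤|M| with minSepCert cert
  ... | P , certP , minimal = r , r>0 , (P , certP , 1≤|P| , r*|P|≡sepSum) , r-minimal
    where
    1≤|P| : 1 ≤ length P
    1≤|P| = subst (1 ≤_) (volCert-length cert certP) 1≤|M|
    |P|>0 : 0ℚ < ℕ→ℚ (length P)
    |P|>0 = ℕ→ℚ-mono-< 1≤|P|
    instance
      |P|-positive : ℚ.Positive (ℕ→ℚ (length P))
      |P|-positive = ℚ.positive |P|>0
      |P|-nonZero : ℚ.NonZero (ℕ→ℚ (length P))
      |P|-nonZero = ℚₚ.pos⇒nonZero (ℕ→ℚ (length P))
      |P|-nonNegative : ℚ.NonNegative (ℕ→ℚ (length P))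
      |P|-nonNegative = ℚₚ.pos⇒nonNeg (ℕ→ℚ (length P))
    r : ℚ
    r = ℕ→ℚ (sepSum P) ÷ ℕ→ℚ (length P)
    r*|P|≡sepSum : r * ℕ→ℚ (length P) ≡ ℕ→ℚ (sepSum P)
    r*|P|≡sepSum = ÷-*-cancel (ℕ→ℚ (sepSum P)) (ℕ→ℚ (length P))
    r>0 : 0ℚ < r
    r>0 = ℚₚ.*-cancelʳ-<-nonNeg (ℕ→ℚ (length P))
      (subst₂ _<_ (sym (ℚₚ.*-zeroˡ (ℕ→ℚ (length P)))) (sym r*|P|≡sepSum) (ℕ→ℚ-mono-< {0} (sepSum-pos (proj₁ certP) 1≤|P|)))
    r-minimal : ∀ ps r′ → IsVolCert S ps → SepDistOfPairIs ps r′ → r ≤q r′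
    r-minimal ps r′ cert-ps (_ , r′*|ps|≡sepSum) = ℚₚ.*-cancelʳ-≤-pos (ℕ→ℚ (length P)) (begin
      r * ℕ→ℚ (length P)    ≡⟨ r*|P|≡sepSum ⟩
      ℕ→ℚ (sepSum P)        ≤⟨ ℕ→ℚ-mono-≤ (minimal cert-ps) ⟩
      ℕ→ℚ (sepSum ps)       ≡⟨ r′*|ps|≡sepSum ⟨
      r′ * ℕ→ℚ (length ps)  ≡⟨ cong (λ n → r′ * ℕ→ℚ n) (volCert-length cert-ps certP) ⟩
      r′ * ℕ→ℚ (length P)   ∎)
      where open ℚₚ.≤-Reasoning

-- Distance to monotonicity

module MonotoneRepair {d} {f : Vertex d → Bool} {M : Matching d} (cert : IsVolCert f M) where

  open import Data.List.Membership.DecPropositional (_≟V_ {d}) using (_∈?_)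

  matched : List (Vertex d)
  matched = map proj₁ M ++ map proj₂ M

  UnmatchedOneBelow : Vertex d → Vertex d → Set
  UnmatchedOneBelow x y = (y ≼ x) × (y ∉ matched) × (f y ≡ true)

  unmatchedOneBelow? : ∀ x → Dec (Any (UnmatchedOneBelow x) (allVerts d))
  unmatchedOneBelow? x = any? (λ y → (y ≼? x) ×-dec (¬? (y ∈? matched)) ×-dec (f y Boolₚ.≟ true)) (allVerts d)

  repair : Vertex d → Bool
  repair x = isYes (unmatchedOneBelow? x)

  repair-intro : ∀ x y → UnmatchedOneBelow x y → repair x ≡ true
  repair-intro x y below =
    trans (isYes≗does (unmatchedOneBelow? x)) (dec-true (unmatchedOneBelow? x) (Any.map (λ { refl → below }) (∈-allVerts y)))

  repair-elim : ∀ x → repair x ≡ true → ∃ (UnmatchedOneBelow x)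
  repair-elim x repair≡true = Any.satisfied (toWitness {a? = unmatchedOneBelow? x} (subst T (sym repair≡true) tt))

  unmatched-no-violation : ∀ {z x} → z ≼ x → f z ≡ true → f x ≡ false → z ∉ matched → x ∉ matched → ⊥
  unmatched-no-violation {z} {x} z≼x fz fx z-unmatched x-unmatched =
    ℕₚ.<-irrefl refl (proj₂ cert ((z , x) ∷ M) extended)
    where
    z≢x : z ≢ x
    z≢x refl with () ← trans (sym fz) fx
    extended : IsMatchedPairIn f ((z , x) ∷ M)
    extended with proj₁ cert
    ... | pairs-ok , sources-unique , targets-unique =
        (fz , fx , z≢x , z≼x) ∷ pairs-ok
      , ¬Any⇒All¬ (map proj₁ M) (z-unmatched ∘ ∈-++⁺ˡ) ∷ sources-unique
      , ¬Any⇒All¬ (map proj₂ M) (x-unmatched ∘ ∈-++⁺ʳ (map proj₁ M)) ∷ targets-unique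

  repair-monotone : Monotone repair
  repair-monotone x y (_ , x≼y) with repair x in repair-x
  ... | false = Boolₚ.≤-minimum (repair y)
  ... | true with repair-elim x repair-x
  ...   | z , z≼x , z-unmatched , fz =
    Boolₚ.≤-reflexive (sym (repair-intro y z ((λ i → Boolₚ.≤-trans (z≼x i) (x≼y i)) , z-unmatched , fz)))

  repair-agrees : ∀ {x} → x ∉ matched → f x ≡ repair x
  repair-agrees {x} x-unmatched with f x in fx | repair x in repair-x
  ... | true  | true  = refl
  ... | false | false = refl
  ... | true  | false with () ← trans (sym (repair-intro x x ((λ _ → Boolₚ.≤-refl) , x-unmatched , fx))) repair-x
  ... | false | true with repair-elim x repair-x
  ...   | z , z≼x , z-unmatched , fz = ⊥-elim (unmatched-no-violation z≼x fz fx z-unmatched x-unmatched)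

  disagree-repair≤ : disagree f repair ≤ length M + length M
  disagree-repair≤ = begin
    disagree f repair                                    ≤⟨ sumℕ-mono-≤ (allVerts d) disagreement≤occurrences ⟩
    sumℕ (map (λ x → occurrences x matched) (allVerts d)) ≡⟨ sum-occurrences d matched ⟩
    length matched                                       ≡⟨ Listₚ.length-++ (map proj₁ M) ⟩
    length (map proj₁ M) + length (map proj₂ M)          ≡⟨ cong₂ _+_ (Listₚ.length-map proj₁ M) (Listₚ.length-map proj₂ M) ⟩
    length M + length M                                  ∎
    where
    open ℕₚ.≤-Reasoning
    disagreement≤occurrences : ∀ x → ind (f x xor repair x) ≤ occurrences x matched
    disagreement≤occurrences x with x ∈? matched
    ... | yes x-matched  = ℕₚ.≤-trans (ind≤1 (f x xor repair x)) (∈⇒occurrences-pos x-matched)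
      where
      ind≤1 : ∀ b → ind b ≤ 1
      ind≤1 false = z≤n
      ind≤1 true  = s≤s z≤n
    ... | no x-unmatched rewrite sym (repair-agrees x-unmatched) | Boolₚ.xor-same (f x) = z≤n

distMonoCount≤2*vol : ∀ {d} {f : Vertex d → Bool} {M k} → IsVolCert f M → IsDistMonoCount f k → k ≤ length M + length M
distMonoCount≤2*vol cert (_ , k-minimal) =
  ℕₚ.≤-trans (k-minimal repair repair-monotone) disagree-repair≤
  where open MonotoneRepair cert

-- Flows in the network of (P)

+-cancelʳ-≤ : ∀ p q r → p +q r ≤q q +q r → p ≤q q
+-cancelʳ-≤ p q r p+r≤q+r = subst₂ _≤q_ (cancel p) (cancel q) (ℚₚ.+-monoˡ-≤ (- r) p+r≤q+r)
  where
  cancel : ∀ x → x +q r +q - r ≡ x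
  cancel x = trans (ℚₚ.+-assoc x r (- r)) (trans (cong (x +q_) (ℚₚ.+-inverseʳ r)) (ℚₚ.+-identityʳ x))

≤-+-nonneg : ∀ {p q} → 0ℚ ≤q p → q ≤q p +q q
≤-+-nonneg {p} {q} p≥0 = subst (_≤q p +q q) (ℚₚ.+-identityˡ q) (ℚₚ.+-monoˡ-≤ q p≥0)

≤-squares⇒≤-* : ∀ {c u r} → 0ℚ ≤q u → 0ℚ ≤q r → c ≤q u * u → c ≤q r * r → c ≤q r * u
≤-squares⇒≤-* {c} {u} {r} u≥0 r≥0 c≤u² c≤r² with ℚₚ.≤-total u r
... | inj₁ u≤r = ℚₚ.≤-trans c≤u² (ℚₚ.*-monoʳ-≤-nonNeg u {{ℚ.nonNegative u≥0}} u≤r)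
... | inj₂ r≤u = ℚₚ.≤-trans c≤r² (ℚₚ.*-monoˡ-≤-nonNeg r {{ℚ.nonNegative r≥0}} r≤u)

≤-halve : ∀ {C s k} v → 0ℚ < C → k ≤ v + v → C * ℕ→ℚ v ≤q s → C * ½ * ℕ→ℚ k ≤q s
≤-halve {C} {s} {k} v C>0 k≤2v Cv≤s = begin
  C * ½ * ℕ→ℚ k           ≤⟨ ℚₚ.*-monoˡ-≤-nonNeg (C * ½) {{C/2≥0}} (ℕ→ℚ-mono-≤ k≤2v) ⟩
  C * ½ * ℕ→ℚ (v + v)     ≡⟨ cong (C * ½ *_) (ℕ→ℚ-+ v v) ⟩
  C * ½ * (V +q V)         ≡⟨ ℚₚ.*-distribˡ-+ (C * ½) V V ⟩
  C * ½ * V +q C * ½ * V   ≡⟨ ℚₚ.*-distribʳ-+ V (C * ½) (C * ½) ⟨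
  (C * ½ +q C * ½) * V     ≡⟨ cong (_* V) (trans (sym (ℚₚ.*-distribˡ-+ C ½ ½)) (ℚₚ.*-identityʳ C)) ⟩
  C * V                    ≤⟨ Cv≤s ⟩
  s                        ∎
  where
  open ℚₚ.≤-Reasoning
  V : ℚ
  V = ℕ→ℚ v
  C/2≥0 : ℚ.NonNegative (C * ½)
  C/2≥0 = ℚₚ.pos⇒nonNeg (C * ½) {{ℚₚ.pos*pos⇒pos C {{ℚ.positive C>0}} ½}}

when : Bool → ℚ → ℚ
when b q = if b then q else 0ℚ

when-nonneg : ∀ b {q} → 0ℚ ≤q q → 0ℚ ≤q when b q
when-nonneg true  q≥0 = q≥0
when-nonneg false _   = ℚₚ.≤-refl

when-≤ : ∀ b {q} → 0ℚ ≤q q → when b q ≤q q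
when-≤ true  _   = ℚₚ.≤-refl
when-≤ false q≥0 = q≥0

when-≤-ind : ∀ b {q} → q ≤q 1ℚ → when b q ≤q ℕ→ℚ (ind b)
when-≤-ind true  q≤1 = q≤1
when-≤-ind false _   = ℚₚ.≤-refl

when-0 : ∀ b → when b 0ℚ ≡ 0ℚ
when-0 true  = refl
when-0 false = refl

when-sum : ∀ {a} {A : Set a} b (g : A → ℚ) xs → when b (sumℚ (map g xs)) ≡ sumℚ (map (λ x → when b (g x)) xs)
when-sum true  g xs = refl
when-sum false g xs = sym (ℚΣ.sum-map-ε xs)

when-split : ∀ a b {q} → 0ℚ ≤q q → when a q ≤q when b q +q when (a ∧ not b) q
when-split true  true  _   = ℚₚ.≤-reflexive (sym (ℚₚ.+-identityʳ _))
when-split true  false _   = ℚₚ.≤-reflexive (sym (ℚₚ.+-identityˡ _))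
when-split false b     q≥0 = ℚₚ.+-mono-≤ (when-nonneg b q≥0) ℚₚ.≤-refl

when-colour-split : ∀ a b c {q} → 0ℚ ≤q q →
  when (a ∧ not b) q ≤q when (a ∧ not b ∧ (c ==ᵇ a)) q +q when (a ∧ not b ∧ (c ==ᵇ b)) q
when-colour-split true  false true  _ = ℚₚ.≤-reflexive (sym (ℚₚ.+-identityʳ _))
when-colour-split true  false false _ = ℚₚ.≤-reflexive (sym (ℚₚ.+-identityˡ _))
when-colour-split true  true  c     _ = ℚₚ.≤-refl
when-colour-split false b     c     _ = ℚₚ.≤-refl

violatedOut violatedIn : ∀ {d} → (Vertex d → Bool) → Coloring d → Vertex d → Fin d → Bool
violatedOut f χ x i = f x ∧ not (f (flip x i)) ∧ (χ x i ==ᵇ f x)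
violatedIn  f χ x i = f (flip x i) ∧ not (f x) ∧ (χ (flip x i) i ==ᵇ f x)

-- The summand of Iminus is defined by `with`, so it cannot be named here; the
-- metavariable in the type of Iminus-summand-≡ is solved from its use in Iminus-≡.
mutual
  Iminus-≡ : ∀ {d} (f : Vertex d → Bool) (χ : Coloring d) x →
    Iminus f χ x ≡ sumℕ (map (λ i → ind (if lookup x i then violatedIn f χ x i else violatedOut f χ x i)) (allCoords d))
  Iminus-≡ {d} f χ x = cong sumℕ (Listₚ.map-cong (Iminus-summand-≡ f χ x) (allCoords d))

  Iminus-summand-≡ : ∀ {d} (f : Vertex d → Bool) (χ : Coloring d) x i →
    _ ≡ ind (if lookup x i then violatedIn f χ x i else violatedOut f χ x i)
  Iminus-summand-≡ f χ x i with lookup x i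
  ... | true  = refl
  ... | false = refl

module FlowBound {d} (f : Vertex d → Bool) (χ : Coloring d) (r : ℚ) (F : Flow d)
  (edge-cap     : ∀ x i → lookup x i ≡ false → (0ℚ ≤q edgeFlow F x i) × (edgeFlow F x i ≤q ℕ→ℚ 1))
  (no-edge      : ∀ x i → lookup x i ≡ true → edgeFlow F x i ≡ 0ℚ)
  (src-nonneg   : ∀ x → 0ℚ ≤q srcFlow F x)
  (src-outside  : ∀ x → f x ≡ false → srcFlow F x ≡ 0ℚ)
  (snk-nonneg   : ∀ x → 0ℚ ≤q snkFlow F x)
  (snk-inside   : ∀ x → f x ≡ true → snkFlow F x ≡ 0ℚ)
  (conservation : ∀ x → inflow F x ≡ outflow F x)
  (vertex-cap   : ∀ x → inflow F x ≤q r * r)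
  where

  e : Vertex d → Fin d → ℚ
  e = edgeFlow F

  Σᵥ : (Vertex d → ℚ) → ℚ
  Σᵥ h = sumℚ (map h (allVerts d))

  Σᵢ : (Fin d → ℚ) → ℚ
  Σᵢ h = sumℚ (map h (allCoords d))

  e-nonneg : ∀ x i → 0ℚ ≤q e x i
  e-nonneg x i with lookup x i in x-i
  ... | false = proj₁ (edge-cap x i x-i)
  ... | true  = ℚₚ.≤-reflexive (sym (no-edge x i x-i))

  e≤1 : ∀ x i → e x i ≤q 1ℚ
  e≤1 x i with lookup x i in x-i
  ... | false = proj₂ (edge-cap x i x-i)
  ... | true  = subst (_≤q 1ℚ) (sym (no-edge x i x-i)) (ℕ→ℚ-nonneg 1)

  no-edge-from-flip : ∀ x i → lookup x i ≡ false → e (flip x i) i ≡ 0ℚ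
  no-edge-from-flip x i x-i = no-edge (flip x i) i (trans (lookup-flip x i) (cong not x-i))

  inEdges outEdges : Vertex d → ℚ
  inEdges  x = Σᵢ (λ i → e (flip x i) i)
  outEdges x = Σᵢ (e x)

  inflow≡ : ∀ x → inflow F x ≡ srcFlow F x +q inEdges x
  inflow≡ x = cong (srcFlow F x +q_) (cong sumℚ (Listₚ.map-cong summand (allCoords d)))
    where
    summand : ∀ i → (if lookup x i then e (flip x i) i else 0ℚ) ≡ e (flip x i) i
    summand i with lookup x i in x-i
    ... | true  = refl
    ... | false = sym (no-edge-from-flip x i x-i)

  outflow≡ : ∀ x → outflow F x ≡ snkFlow F x +q outEdges x
  outflow≡ x = cong (snkFlow F x +q_) (cong sumℚ (Listₚ.map-cong summand (allCoords d)))
    where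
    summand : ∀ i → (if lookup x i then 0ℚ else e x i) ≡ e x i
    summand i with lookup x i in x-i
    ... | true  = sym (no-edge x i x-i)
    ... | false = refl

  src+in≡out : ∀ x → srcFlow F x +q when (f x) (inEdges x) ≡ when (f x) (outEdges x)
  src+in≡out x with f x in fx
  ... | false = cong (_+q 0ℚ) (src-outside x fx)
  ... | true  = begin
    srcFlow F x +q inEdges x   ≡⟨ inflow≡ x ⟨
    inflow F x                 ≡⟨ conservation x ⟩
    outflow F x                ≡⟨ outflow≡ x ⟩
    snkFlow F x +q outEdges x  ≡⟨ cong (_+q outEdges x) (snk-inside x fx) ⟩
    0ℚ +q outEdges x           ≡⟨ ℚₚ.+-identityˡ (outEdges x) ⟩
    outEdges x                 ∎
    where open ≡-Reasoning

  flowValue+in≡out : flowValue F +q Σᵥ (λ x → when (f x) (inEdges x)) ≡ Σᵥ (λ x → when (f x) (outEdges x))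
  flowValue+in≡out = trans (sym (ℚΣ.sum-map-∙ (srcFlow F) (λ x → when (f x) (inEdges x)) (allVerts d)))
                           (cong sumℚ (Listₚ.map-cong src+in≡out (allVerts d)))

  Σ-when-comm : ∀ (g : Vertex d → Fin d → ℚ) →
    Σᵥ (λ x → when (f x) (Σᵢ (g x))) ≡ Σᵢ (λ i → Σᵥ (λ x → when (f x) (g x i)))
  Σ-when-comm g = trans (cong sumℚ (Listₚ.map-cong (λ x → when-sum (f x) (g x) (allCoords d)) (allVerts d)))
                        (ℚΣ.sum-map-comm (λ x i → when (f x) (g x i)) (allVerts d) (allCoords d))

  in-by-edges : Σᵥ (λ x → when (f x) (inEdges x)) ≡ Σᵢ (λ i → Σᵥ (λ y → when (f (flip y i)) (e y i)))
  in-by-edges = trans (Σ-when-comm (λ x i → e (flip x i) i)) (cong sumℚ (Listₚ.map-cong by-heads (allCoords d)))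
    where
    by-heads : ∀ i → Σᵥ (λ x → when (f x) (e (flip x i) i)) ≡ Σᵥ (λ y → when (f (flip y i)) (e y i))
    by-heads i = trans
      (cong sumℚ (Listₚ.map-cong (λ x → cong (λ z → when (f z) (e (flip x i) i)) (sym (flip-involutive x i))) (allVerts d)))
      (ℚΣ.sum-flip d i (λ y → when (f (flip y i)) (e y i)))

  violatedFlow : ℚ
  violatedFlow = Σᵢ (λ i → Σᵥ (λ y → when (f y ∧ not (f (flip y i))) (e y i)))

  out≤in+violated : Σᵥ (λ x → when (f x) (outEdges x)) ≤q Σᵥ (λ x → when (f x) (inEdges x)) +q violatedFlow
  out≤in+violated = begin
    Σᵥ (λ x → when (f x) (outEdges x))
      ≡⟨ Σ-when-comm e ⟩
    Σᵢ (λ i → Σᵥ (λ y → when (f y) (e y i)))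
      ≤⟨ sumℚ-mono-≤ (allCoords d) (λ i → sumℚ-mono-≤ (allVerts d) (λ y → when-split (f y) (f (flip y i)) (e-nonneg y i))) ⟩
    Σᵢ (λ i → Σᵥ (λ y → when (f (flip y i)) (e y i) +q when (f y ∧ not (f (flip y i))) (e y i)))
      ≡⟨ cong sumℚ (Listₚ.map-cong (λ i → ℚΣ.sum-map-∙ _ _ (allVerts d)) (allCoords d)) ⟩
    Σᵢ (λ i → Σᵥ (λ y → when (f (flip y i)) (e y i)) +q Σᵥ (λ y → when (f y ∧ not (f (flip y i))) (e y i)))
      ≡⟨ ℚΣ.sum-map-∙ _ _ (allCoords d) ⟩
    Σᵢ (λ i → Σᵥ (λ y → when (f (flip y i)) (e y i))) +q violatedFlow
      ≡⟨ cong (_+q violatedFlow) in-by-edges ⟨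
    Σᵥ (λ x → when (f x) (inEdges x)) +q violatedFlow
      ∎
    where open ℚₚ.≤-Reasoning

  flowValue≤violatedFlow : flowValue F ≤q violatedFlow
  flowValue≤violatedFlow = +-cancelʳ-≤ (flowValue F) violatedFlow (Σᵥ (λ x → when (f x) (inEdges x)))
    (subst₂ _≤q_ (sym flowValue+in≡out) (ℚₚ.+-comm _ violatedFlow) out≤in+violated)

  -- The flow on a violated edge is charged to the endpoint whose f-value is its colour.
  outCharge inCharge : Vertex d → Fin d → ℚ
  outCharge y i = when (violatedOut f χ y i) (e y i)
  inCharge  y i = when (violatedIn f χ y i) (e (flip y i) i)

  charge : Vertex d → ℚ
  charge y = Σᵢ (λ i → outCharge y i +q inCharge y i)

  inCharge-flip : ∀ y i → inCharge (flip y i) i ≡ when (f y ∧ not (f (flip y i)) ∧ (χ y i ==ᵇ f (flip y i))) (e y i)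
  inCharge-flip y i =
    cong (λ z → when (f z ∧ not (f (flip y i)) ∧ (χ z i ==ᵇ f (flip y i))) (e z i)) (flip-involutive y i)

  violatedFlow≤charges : violatedFlow ≤q Σᵥ charge
  violatedFlow≤charges = begin
    violatedFlow
      ≤⟨ sumℚ-mono-≤ (allCoords d) (λ i → sumℚ-mono-≤ (allVerts d) (λ y →
           ℚₚ.≤-trans (when-colour-split (f y) (f (flip y i)) (χ y i) (e-nonneg y i))
                      (ℚₚ.≤-reflexive (cong (outCharge y i +q_) (sym (inCharge-flip y i)))))) ⟩
    Σᵢ (λ i → Σᵥ (λ y → outCharge y i +q inCharge (flip y i) i))
      ≡⟨ cong sumℚ (Listₚ.map-cong by-tails (allCoords d)) ⟩
    Σᵢ (λ i → Σᵥ (λ y → outCharge y i +q inCharge y i))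
      ≡⟨ ℚΣ.sum-map-comm (λ y i → outCharge y i +q inCharge y i) (allVerts d) (allCoords d) ⟨
    Σᵥ charge
      ∎
    where
    open ℚₚ.≤-Reasoning
    by-tails : ∀ i → Σᵥ (λ y → outCharge y i +q inCharge (flip y i) i) ≡ Σᵥ (λ y → outCharge y i +q inCharge y i)
    by-tails i = begin-equality
      Σᵥ (λ y → outCharge y i +q inCharge (flip y i) i)
        ≡⟨ ℚΣ.sum-map-∙ (λ y → outCharge y i) (λ y → inCharge (flip y i) i) (allVerts d) ⟩
      Σᵥ (λ y → outCharge y i) +q Σᵥ (λ y → inCharge (flip y i) i)
        ≡⟨ cong (Σᵥ (λ y → outCharge y i) +q_) (ℚΣ.sum-flip d i (λ y → inCharge y i)) ⟩
      Σᵥ (λ y → outCharge y i) +q Σᵥ (λ y → inCharge y i)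
        ≡⟨ ℚΣ.sum-map-∙ (λ y → outCharge y i) (λ y → inCharge y i) (allVerts d) ⟨
      Σᵥ (λ y → outCharge y i +q inCharge y i)
        ∎

  charge-summand≤ : ∀ y i →
    outCharge y i +q inCharge y i ≤q ℕ→ℚ (ind (if lookup y i then violatedIn f χ y i else violatedOut f χ y i))
  charge-summand≤ y i with lookup y i in y-i
  ... | true = begin
    outCharge y i +q inCharge y i  ≡⟨ cong (λ q → when (violatedOut f χ y i) q +q inCharge y i) (no-edge y i y-i) ⟩
    when (violatedOut f χ y i) 0ℚ +q inCharge y i  ≡⟨ cong (_+q inCharge y i) (when-0 (violatedOut f χ y i)) ⟩
    0ℚ +q inCharge y i             ≡⟨ ℚₚ.+-identityˡ (inCharge y i) ⟩
    inCharge y i                   ≤⟨ when-≤-ind (violatedIn f χ y i) (e≤1 (flip y i) i) ⟩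
    ℕ→ℚ (ind (violatedIn f χ y i)) ∎
    where open ℚₚ.≤-Reasoning
  ... | false = begin
    outCharge y i +q inCharge y i  ≡⟨ cong (λ q → outCharge y i +q when (violatedIn f χ y i) q) (no-edge-from-flip y i y-i) ⟩
    outCharge y i +q when (violatedIn f χ y i) 0ℚ  ≡⟨ cong (outCharge y i +q_) (when-0 (violatedIn f χ y i)) ⟩
    outCharge y i +q 0ℚ            ≡⟨ ℚₚ.+-identityʳ (outCharge y i) ⟩
    outCharge y i                  ≤⟨ when-≤-ind (violatedOut f χ y i) (e≤1 y i) ⟩
    ℕ→ℚ (ind (violatedOut f χ y i)) ∎
    where open ℚₚ.≤-Reasoning

  charge≤Iminus : ∀ y → charge y ≤q ℕ→ℚ (Iminus f χ y)
  charge≤Iminus y = begin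
    charge y                            ≤⟨ sumℚ-mono-≤ (allCoords d) (charge-summand≤ y) ⟩
    sumℚ (map (ℕ→ℚ ∘ count) (allCoords d)) ≡⟨ cong sumℚ (Listₚ.map-∘ (allCoords d)) ⟩
    sumℚ (map ℕ→ℚ (map count (allCoords d))) ≡⟨ ℕ→ℚ-sum (map count (allCoords d)) ⟨
    ℕ→ℚ (sumℕ (map count (allCoords d)))  ≡⟨ cong ℕ→ℚ (Iminus-≡ f χ y) ⟨
    ℕ→ℚ (Iminus f χ y)                  ∎
    where
    open ℚₚ.≤-Reasoning
    count : Fin d → ℕ
    count i = ind (if lookup y i then violatedIn f χ y i else violatedOut f χ y i)

  charge≤r²-inside : ∀ y → f y ≡ true → charge y ≤q r * r
  charge≤r²-inside y fy = begin
    charge y                    ≤⟨ sumℚ-mono-≤ (allCoords d) summand≤out ⟩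
    outEdges y                  ≤⟨ ≤-+-nonneg (snk-nonneg y) ⟩
    snkFlow F y +q outEdges y   ≡⟨ trans (conservation y) (outflow≡ y) ⟨
    inflow F y                  ≤⟨ vertex-cap y ⟩
    r * r                       ∎
    where
    open ℚₚ.≤-Reasoning
    summand≤out : ∀ i → outCharge y i +q inCharge y i ≤q e y i
    summand≤out i = begin
      outCharge y i +q inCharge y i  ≡⟨ cong (λ b → outCharge y i +q when b (e (flip y i) i)) no-in-violation ⟩
      outCharge y i +q 0ℚ            ≡⟨ ℚₚ.+-identityʳ (outCharge y i) ⟩
      outCharge y i                  ≤⟨ when-≤ (violatedOut f χ y i) (e-nonneg y i) ⟩
      e y i                          ∎
      where
      no-in-violation : violatedIn f χ y i ≡ false
      no-in-violation = trans (cong (λ b → f (flip y i) ∧ not b ∧ (χ (flip y i) i ==ᵇ b)) fy)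
                              (Boolₚ.∧-zeroʳ (f (flip y i)))
  charge≤r²-outside : ∀ y → f y ≡ false → charge y ≤q r * r
  charge≤r²-outside y fy = begin
    charge y                    ≤⟨ sumℚ-mono-≤ (allCoords d) summand≤in ⟩
    inEdges y                   ≤⟨ ≤-+-nonneg (src-nonneg y) ⟩
    srcFlow F y +q inEdges y    ≡⟨ inflow≡ y ⟨
    inflow F y                  ≤⟨ vertex-cap y ⟩
    r * r                       ∎
    where
    open ℚₚ.≤-Reasoning
    summand≤in : ∀ i → outCharge y i +q inCharge y i ≤q e (flip y i) i
    summand≤in i = begin
      outCharge y i +q inCharge y i  ≡⟨ cong (λ b → when b (e y i) +q inCharge y i) no-out-violation ⟩
      0ℚ +q inCharge y i             ≡⟨ ℚₚ.+-identityˡ (inCharge y i) ⟩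
      inCharge y i                   ≤⟨ when-≤ (violatedIn f χ y i) (e-nonneg (flip y i) i) ⟩
      e (flip y i) i                 ∎
      where
      no-out-violation : violatedOut f χ y i ≡ false
      no-out-violation = cong (λ b → b ∧ not (f (flip y i)) ∧ (χ y i ==ᵇ b)) fy

  charge≤r² : ∀ y → charge y ≤q r * r
  charge≤r² y = by-value (f y) refl
    where
    by-value : ∀ b → f y ≡ b → charge y ≤q r * r
    by-value true  = charge≤r²-inside y
    by-value false = charge≤r²-outside y

  flowValue≤ : 0ℚ ≤q r → (u : Vertex d → ℚ) → (∀ x → (0ℚ ≤q u x) × (ℕ→ℚ (Iminus f χ x) ≤q u x * u x)) →
    flowValue F ≤q r * Σᵥ u
  flowValue≤ r≥0 u u≥√I = begin
    flowValue F       ≤⟨ flowValue≤violatedFlow ⟩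
    violatedFlow      ≤⟨ violatedFlow≤charges ⟩
    Σᵥ charge         ≤⟨ sumℚ-mono-≤ (allVerts d) charge≤ru ⟩
    Σᵥ (λ y → r * u y) ≡⟨ sumℚ-*ˡ r u (allVerts d) ⟩
    r * Σᵥ u          ∎
    where
    open ℚₚ.≤-Reasoning
    charge≤ru : ∀ y → charge y ≤q r * u y
    charge≤ru y with u≥√I y
    ... | u≥0 , I≤u² = ≤-squares⇒≤-* u≥0 r≥0 (ℚₚ.≤-trans (charge≤Iminus y) I≤u²) (charge≤r² y)

feasibleFlow≤ : ∀ {d} {f : Vertex d → Bool} {r F} (χ : Coloring d) → IsFeasibleFlow f r F → 0ℚ ≤q r →
  (u : Vertex d → ℚ) → (∀ x → (0ℚ ≤q u x) × (ℕ→ℚ (Iminus f χ x) ≤q u x * u x)) →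
  flowValue F ≤q r * sumℚ (map u (allVerts d))
feasibleFlow≤ {f = f} {r} {F} χ (edge-cap , no-edge , src≥0 , src-outside , snk≥0 , snk-inside , conservation , vertex-cap) =
  FlowBound.flowValue≤ f χ r F edge-cap no-edge src≥0 src-outside snk≥0 snk-inside conservation vertex-cap

FlowLowerBound : ℚ → Set
FlowLowerBound C = ∀ (d : ℕ) → 1 ≤ d → ∀ (S : Vertex d → Bool) (v : ℕ) (r : ℚ) →
  IsDirVol S v → 1 ≤ v → IsSepDist S r → MaxFlowAtLeast S r (C * r * ℕ→ℚ v)

positive-volume-≤-sqrtSum : ∀ {C d} → FlowLowerBound C → 1 ≤ d → ∀ {f : Vertex d → Bool} {M} (χ : Coloring d) →
  IsVolCert f M → 1 ≤ length M → SqrtSumAtLeast (Iminus f χ) (C * ℕ→ℚ (length M))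
positive-volume-≤-sqrtSum {C} {d} flow-bound 1≤d {f} {M} χ cert 1≤|M| u u≥√I =
  let r , r>0 , sep          = sepDist-exists f cert 1≤|M|
      F , feasible , flow≥   = flow-bound d 1≤d f (length M) r (M , cert , refl) 1≤|M| sep
      open ℚₚ.≤-Reasoning
  in ℚₚ.*-cancelˡ-≤-pos r {{ℚ.positive r>0}} (begin
    r * (C * ℕ→ℚ (length M))       ≡⟨ ℚₚ.*-assoc r C _ ⟨
    r * C * ℕ→ℚ (length M)         ≡⟨ cong (_* ℕ→ℚ (length M)) (ℚₚ.*-comm r C) ⟩
    C * r * ℕ→ℚ (length M)         ≤⟨ flow≥ ⟩
    flowValue F                     ≤⟨ feasibleFlow≤ χ feasible (ℚₚ.<⇒≤ r>0) u u≥√I ⟩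
    r * sumℚ (map u (allVerts d))   ∎)

volume-≤-sqrtSum : ∀ {C d} → FlowLowerBound C → 1 ≤ d → ∀ {f : Vertex d → Bool} {M} (χ : Coloring d) →
  IsVolCert f M → SqrtSumAtLeast (Iminus f χ) (C * ℕ→ℚ (length M))
volume-≤-sqrtSum {C} {d} flow-bound 1≤d {f} {M} χ cert u u≥√I = case 1 ℕ.≤? length M of λ where
  (yes 1≤|M|) → positive-volume-≤-sqrtSum {C} flow-bound 1≤d χ cert 1≤|M| u u≥√I
  (no |M|<1)  → subst (λ n → C * ℕ→ℚ n ≤q sumℚ (map u (allVerts d))) (sym (ℕₚ.n<1⇒n≡0 (ℕₚ.≰⇒> |M|<1)))
                  (subst (_≤q sumℚ (map u (allVerts d))) (sym (ℚₚ.*-zeroʳ C)) (sumℚ-nonneg (allVerts d) (proj₁ ∘ u≥√I)))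

claim4p11 : PropertyP →
    Σ ℚ λ c → (0ℚ < c) ×
    (∀ (d : ℕ) → 1 ≤ d → ∀ (f : Vertex d → Bool) (χ : Coloring d) (k : ℕ) →
    IsDistMonoCount f k →
    SqrtSumAtLeast (Iminus f χ) (c * ℕ→ℚ k))
claim4p11 (C , C>0 , flow-bound) =
  C * ½ , ℚₚ.positive⁻¹ (C * ½) {{ℚₚ.pos*pos⇒pos C {{ℚ.positive C>0}} ½}} ,
  λ d 1≤d f χ k distMono u u≥√I →
    let M , cert = volCert-exists f in
    ≤-halve (length M) C>0 (distMonoCount≤2*vol cert distMono) (volume-≤-sqrtSum {C} flow-bound 1≤d χ cert u u≥√I)
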